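{- Let $S(G,\sigma)$ be a terminating sandpile instance where $G$ is a tree rooted at $r$. Then $\mathbf{c}(r)=\mathbf{c}^{\downarrow}(r)$, and for every vertex $u\ne r$, $\mathbf{c}(u)=\mathbf{c}^{\downarrow}(u)+\delta(u,\mathbf{c}(\mathrm{parent}(u)))$, where $\delta(u,\cdot)$ is taken with respect to the configuration $\mathrm{final}(\sigma,u)$.
   Context: Sandpile without sinks: $\sigma\in\mathbb{N}^{V(G)}$ gives chip counts; vertex $v$ is full if $\sigma_v\ge\deg(v)$; firing $v$ decreases $\sigma_v$ by $\deg(v)$ and adds one chip to each neighbor; the instance terminates if some finite firing sequence reaches a configuration with no full vertex. $\mathbf{c}(v)$ is the firing number of $v$: the number of times $v$ fires until the terminal configuration is reached (independent of firing order). $\mathrm{subtree}(v)$ is the vertex set of the subtree rooted at $v$ (including $v$), $\mathrm{parent}(v)$ its parent. For a configuration $\tau$, $\mathrm{final}(\tau,v)$ is obtained by repeatedly firing full vertices of $\mathrm{subtree}(v)$ only until none is full (well defined, order independent); $\mathbf{c}^{\downarrow}(v)$ is the number of times $v$ fires in computing $\mathrm{final}(\sigma,v)$ from the initial configuration $\sigma$. For non-root $u$ and a configuration $\tau$ with $\tau_w<\deg(w)$ for all $w\in\mathrm{subtree}(u)$, $\delta(u,x)=\mathrm{final}(\tau+x e_u,u)_{\mathrm{parent}(u)}-\tau_{\mathrm{parent}(u)}$ for integers $x\ge0$, $e_u$ the indicator vector of $u$. -}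

module Defs where

open import Data.Nat using (ℕ; zero; suc; _+_; _∸_; _≤_; _<_)
open import Data.Bool using (Bool; true; false; if_then_else_; _∧_; _∨_; not)
open import Data.Fin using (Fin)
open import Data.Fin.Properties using (_≟_)
open import Data.List using (List; []; _∷_; map; allFin)
open import Data.Nat.ListAction using (sum)
open import Data.Unit using (⊤)
open import Data.Product using (∃)
open import Function using (_∘_)
open import Relation.Nullary using (¬_; does)
open import Relation.Binary.PropositionalEquality using (_≡_)

-- A rooted tree on the vertex set Fin n, encoded by its root and its
-- parent map (with the convention parent root = root).  The depth
-- function witnesses that iterating parent from any vertex reaches the
-- root, i.e. the graph below is connected and acyclic.  Every rooted
-- tree on Fin n arises this way.
record RootedTree (n : ℕ) : Set where
  field
    root         : Fin n
    parent       : Fin n → Fin n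
    depth        : Fin n → ℕ
    parent-root  : parent root ≡ root
    depth-root   : depth root ≡ 0
    depth-parent : ∀ v → ¬ (v ≡ root) → suc (depth (parent v)) ≡ depth v

Config : ℕ → Set
Config n = Fin n → ℕ

_==_ : ∀ {n} → Fin n → Fin n → Bool
a == b = does (a ≟ b)

iterate : ∀ {A : Set} → (A → A) → ℕ → A → A
iterate f zero    x = x
iterate f (suc k) x = f (iterate f k x)

count : ∀ {n} → Fin n → List (Fin n) → ℕ
count v []       = 0
count v (w ∷ ws) = (if w == v then 1 else 0) + count v ws

module Sandpile {n : ℕ} (T : RootedTree n) where
  open RootedTree T

  adj : Fin n → Fin n → Bool
  adj u w = (not (w == root) ∧ (parent w == u)) ∨ (not (u == root) ∧ (parent u == w))

  deg : Fin n → ℕ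
  deg v = sum (map (λ w → if adj v w then 1 else 0) (allFin n))

  fire : Config n → Fin n → Config n
  fire σ v w = if w == v then σ w ∸ deg v
               else (if adj v w then suc (σ w) else σ w)

  InSubtree : Fin n → Fin n → Set
  InSubtree u w = ∃ λ k → iterate parent k w ≡ u

  data Run (S : Fin n → Set) : Config n → List (Fin n) → Config n → Set where
    done : ∀ σ → Run S σ [] σ
    step : ∀ {σ τ vs} v → S v → deg v ≤ σ v → Run S (fire σ v) vs τ → Run S σ (v ∷ vs) τ

  StableOn : (Fin n → Set) → Config n → Set
  StableOn S τ = ∀ w → S w → τ w < deg w

  Everywhere : Fin n → Set
  Everywhere _ = ⊤

  addAt : Config n → Fin n → ℕ → Config n
  addAt τ u x w = if w == u then τ w + x else τ w

{-# OPTIONS --safe #-}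
module Submission where

-- Everything follows from the least action principle: a legal firing sequence never fires a
-- vertex more often than a firing vector u for which σ + Δu is stable.  For the root this
-- compares two stabilizations of σ.  For u ≠ root, the only chips entering subtree(u) from
-- outside are the c(parent u) chips that parent u sends to u; hence firing inside subtree(u)
-- from σ + c(parent u) e_u, first up to final(σ,u) and then on to a stable configuration,
-- fires u exactly c(u) times.  Each firing of u in the second stage sends one chip to
-- parent u, and no other vertex of the subtree does, which is δ(u, c(parent u)).

open import Defs
open import Data.Nat using (ℕ; zero; suc; _+_; _*_; _∸_; _≤_; _<_; z≤n; s≤s)
open import Data.Nat.Properties hiding (_≟_)
open import Data.Bool using (true; false; if_then_else_; not; _∧_; _∨_)
open import Data.Bool.Properties using (∨-comm; ∧-conicalˡ; ∧-conicalʳ; ¬-not)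
open import Data.Fin using (Fin; zero; suc)
open import Data.Fin.Properties using (_≟_)
open import Data.List using (List; _∷_)
open import Data.Product using (_×_; _,_; proj₁; proj₂; uncurry)
open import Data.Sum as Sum using (_⊎_; inj₁; inj₂; reduce)
open import Data.Empty using (⊥-elim)
open import Data.Unit using (⊤; tt)
open import Function using (_∘_)
open import Relation.Nullary using (¬_; Dec; yes; no; does)
open import Relation.Nullary.Decidable using (dec-true; dec-false; map′; decidable-stable)
open import Relation.Binary.PropositionalEquality
open import Algebra.Properties.CommutativeMonoid.Sum +-0-commutativeMonoid
  using (sum; sum-syntax; ∑-distrib-+; sum-cong-≗; sum-replicate-zero)
open import Algebra.Properties.CommutativeSemigroup +-commutativeSemigroup
  using (x∙yz≈xz∙y; xy∙z≈xz∙y)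

==⇒≡ : ∀ {m} {a b : Fin m} → (a == b) ≡ true → a ≡ b
==⇒≡ {a = a} {b} e with a ≟ b
... | yes a≡b = a≡b
==⇒≡ () | no _

not-==⇒≢ : ∀ {m} {a b : Fin m} → not (a == b) ≡ true → ¬ a ≡ b
not-==⇒≢ {a = a} e refl rewrite dec-true (a ≟ a) refl with e
... | ()

∨-true : ∀ {x y} → x ∨ y ≡ true → x ≡ true ⊎ y ≡ true
∨-true {true}  _ = inj₁ refl
∨-true {false} e = inj₂ e

∑-mono-≤ : ∀ {m} {f g : Fin m → ℕ} → (∀ i → f i ≤ g i) → sum f ≤ sum g
∑-mono-≤ {zero}  _   = z≤n
∑-mono-≤ {suc m} f≤g = +-mono-≤ (f≤g zero) (∑-mono-≤ (f≤g ∘ suc))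

∑-point : ∀ {m} (v : Fin m) (f : Fin m → ℕ) → ∑[ x < m ] (if v == x then f x else 0) ≡ f v
∑-point {suc m} zero    f = trans (cong (f zero +_) (sum-replicate-zero m)) (+-identityʳ (f zero))
∑-point         (suc v) f = ∑-point v (f ∘ suc)

module OnTree {n : ℕ} (T : RootedTree n) where
  open RootedTree T
  open Sandpile T

  ancestor-rec : (P : Fin n → Set) → P root → (∀ w → ¬ w ≡ root → P (parent w) → P w) → ∀ w → P w
  ancestor-rec P base up w = go (depth w) w refl
    where
    go : ∀ m w → depth w ≡ m → P w
    go m w d with w ≟ root
    ... | yes refl = base
    go zero    w d | no w≢r = ⊥-elim (1+n≢0 (trans (depth-parent w w≢r) d))
    go (suc m) w d | no w≢r = up w w≢r (go m (parent w) (suc-injective (trans (depth-parent w w≢r) d)))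

  iterate-suc : ∀ k w → iterate parent (suc k) w ≡ iterate parent k (parent w)
  iterate-suc zero    w = refl
  iterate-suc (suc k) w = cong parent (iterate-suc k w)

  iterate-root : ∀ k → iterate parent k root ≡ root
  iterate-root zero    = refl
  iterate-root (suc k) = trans (cong parent (iterate-root k)) parent-root

  parent-≢ : ∀ {v} → ¬ v ≡ root → ¬ parent v ≡ v
  parent-≢ {v} v≢r pv≡v = 1+n≢n (subst (λ z → suc (depth z) ≡ depth v) pv≡v (depth-parent v v≢r))

  depth-parent-≤ : ∀ w → depth (parent w) ≤ depth w
  depth-parent-≤ w with w ≟ root
  ... | yes refl = ≤-reflexive (cong depth parent-root)
  ... | no w≢r   = ≤-trans (n≤1+n _) (≤-reflexive (depth-parent w w≢r))

  depth-ancestor-≤ : ∀ k w → depth (iterate parent k w) ≤ depth w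
  depth-ancestor-≤ zero    w = ≤-refl
  depth-ancestor-≤ (suc k) w = ≤-trans (depth-parent-≤ _) (depth-ancestor-≤ k w)

  subtree-root : ∀ w → InSubtree root w
  subtree-root = ancestor-rec (InSubtree root) (0 , refl)
    (λ w _ (k , e) → suc k , trans (iterate-suc k w) e)

  subtree? : ∀ u w → Dec (InSubtree u w)
  subtree? u = ancestor-rec (λ w → Dec (InSubtree u w)) at-root towards-root
    where
    at-root : Dec (InSubtree u root)
    at-root with root ≟ u
    ... | yes r≡u = yes (0 , r≡u)
    ... | no r≢u  = no λ (k , e) → r≢u (trans (sym (iterate-root k)) e)
    towards-root : ∀ w → ¬ w ≡ root → Dec (InSubtree u (parent w)) → Dec (InSubtree u w)
    towards-root w _ below with w ≟ u
    ... | yes w≡u = yes (0 , w≡u)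
    ... | no w≢u  = map′ (λ (k , e) → suc k , trans (iterate-suc k w) e) up below
      where
      up : InSubtree u w → InSubtree u (parent w)
      up (zero  , e) = ⊥-elim (w≢u e)
      up (suc k , e) = k , trans (sym (iterate-suc k w)) e

  parent∉subtree : ∀ {u} → ¬ u ≡ root → ¬ InSubtree u (parent u)
  parent∉subtree {u} u≢r (k , e) = n≮n (depth u) (begin-strict
    depth u                             ≡⟨ cong depth (sym e) ⟩
    depth (iterate parent k (parent u)) ≤⟨ depth-ancestor-≤ k (parent u) ⟩
    depth (parent u)                    <⟨ ≤-reflexive (depth-parent u u≢r) ⟩
    depth u                             ∎)
    where open ≤-Reasoning

  adj⇒edge : ∀ {x v} → adj x v ≡ true → (¬ v ≡ root × parent v ≡ x) ⊎ (¬ x ≡ root × parent x ≡ v)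
  adj⇒edge e = Sum.map child child (∨-true e)
    where
    child : ∀ {a b} → (not (a == root) ∧ (parent a == b)) ≡ true → ¬ a ≡ root × parent a ≡ b
    child c = not-==⇒≢ (∧-conicalˡ _ _ c) , ==⇒≡ (∧-conicalʳ _ _ c)

  adj-irrefl : ∀ v → adj v v ≡ false
  adj-irrefl v = ¬-not (λ a → uncurry (parent-≢ {v}) (reduce (adj⇒edge a)))

  adj-sym : ∀ x y → adj x y ≡ adj y x
  adj-sym x y = ∨-comm (not (y == root) ∧ (parent y == x)) (not (x == root) ∧ (parent x == y))

  adj-parent : ∀ {u} → ¬ u ≡ root → adj (parent u) u ≡ true
  adj-parent {u} u≢r rewrite dec-false (u ≟ root) u≢r | dec-true (parent u ≟ parent u) refl = refl

  subtree-boundary : ∀ {u v y} → InSubtree u v → ¬ InSubtree u y → adj y v ≡ true → v ≡ u × y ≡ parent u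
  subtree-boundary {u} {v} {y} (k , e) y∉ a with adj⇒edge {y} {v} a
  ... | inj₂ (_ , refl) = ⊥-elim (y∉ (suc k , trans (iterate-suc k y) e))
  ... | inj₁ (_ , refl) with k
  ...   | zero   = e , cong parent e
  ...   | suc k′ = ⊥-elim (y∉ (k′ , trans (sym (iterate-suc k′ v)) e))

  inflow : Fin n → (Fin n → ℕ) → ℕ
  inflow w c = ∑[ x < n ] (if adj x w then c x else 0)

  inflow-cong : ∀ {w} {c c′ : Fin n → ℕ} → (∀ x → adj x w ≡ true → c x ≡ c′ x) → inflow w c ≡ inflow w c′
  inflow-cong {w} c≗c′ = sum-cong-≗ pointwise
    where
    pointwise : ∀ x → (if adj x w then _ else 0) ≡ (if adj x w then _ else 0)
    pointwise x with adj x w in a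
    ... | true  = c≗c′ x a
    ... | false = refl

  inflow-mono : ∀ {w} {c c′ : Fin n → ℕ} → (∀ x → c x ≤ c′ x) → inflow w c ≤ inflow w c′
  inflow-mono {w} c≤c′ = ∑-mono-≤ pointwise
    where
    pointwise : ∀ x → (if adj x w then _ else 0) ≤ (if adj x w then _ else 0)
    pointwise x with adj x w
    ... | true  = c≤c′ x
    ... | false = z≤n

  inflow-+ : ∀ w (c c′ : Fin n → ℕ) → inflow w (λ x → c x + c′ x) ≡ inflow w c + inflow w c′
  inflow-+ w c c′ = trans (sum-cong-≗ pointwise) (∑-distrib-+ (λ x → if adj x w then c x else 0) (λ x → if adj x w then c′ x else 0))
    where
    pointwise : ∀ x → (if adj x w then c x + c′ x else 0) ≡ (if adj x w then c x else 0) + (if adj x w then c′ x else 0)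
    pointwise x with adj x w
    ... | true  = refl
    ... | false = refl

  inflow-point : ∀ w v k → inflow w (λ x → if v == x then k else 0) ≡ (if adj v w then k else 0)
  inflow-point w v k = trans (sum-cong-≗ swap) (∑-point v (λ x → if adj x w then k else 0))
    where
    swap : ∀ x → (if adj x w then (if v == x then k else 0) else 0) ≡ (if v == x then (if adj x w then k else 0) else 0)
    swap x with v == x | adj x w
    ... | true  | true  = refl
    ... | true  | false = refl
    ... | false | true  = refl
    ... | false | false = refl

  inflow-zero : ∀ w → inflow w (λ _ → 0) ≡ 0
  inflow-zero w = trans (sum-cong-≗ pointwise) (sum-replicate-zero n)
    where
    pointwise : ∀ x → (if adj x w then 0 else 0) ≡ 0
    pointwise x with adj x w
    ... | true  = refl
    ... | false = refl

  count-head : ∀ (v : Fin n) p → count v (v ∷ p) ≡ suc (count v p)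
  count-head v p rewrite dec-true (v ≟ v) refl = refl

  run-outside : ∀ {R ρ p τ} → Run R ρ p τ → ∀ x → ¬ R x → count x p ≡ 0
  run-outside (done _)          x x∉ = refl
  run-outside (step v v∈ _ run) x x∉
    rewrite dec-false (v ≟ x) (λ { refl → x∉ v∈ }) = run-outside run x x∉

  -- ρ = σ + Δh for the firing vector h (Δ the sandpile Laplacian), stated without subtraction.
  Balance : Config n → (Fin n → ℕ) → Config n → Set
  Balance σ h ρ = ∀ w → ρ w + deg w * h w ≡ σ w + inflow w h

  add-firing : (Fin n → ℕ) → Fin n → Fin n → ℕ
  add-firing h v x = h x + (if v == x then 1 else 0)

  add-firing-count : ∀ h v p x → add-firing h v x + count x p ≡ h x + count x (v ∷ p)
  add-firing-count h v p x = +-assoc (h x) _ (count x p)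

  balance-zero : ∀ σ → Balance σ (λ _ → 0) σ
  balance-zero σ w = trans (cong (σ w +_) (*-zeroʳ (deg w))) (cong (σ w +_) (sym (inflow-zero w)))

  balance-cong : ∀ {σ h h′ ρ} → (∀ x → h x ≡ h′ x) → Balance σ h ρ → Balance σ h′ ρ
  balance-cong {σ} {h} {h′} {ρ} h≗h′ bal w =
    subst₂ (λ a b → ρ w + deg w * a ≡ σ w + b) (h≗h′ w) (inflow-cong (λ x _ → h≗h′ x)) (bal w)

  fire-balance : ∀ {ρ v} → deg v ≤ ρ v → ∀ w →
    fire ρ v w + deg w * (if v == w then 1 else 0) ≡ ρ w + (if adj v w then 1 else 0)
  fire-balance {ρ} {v} full w with w ≟ v
  ... | yes refl rewrite dec-true (w ≟ w) refl | adj-irrefl w =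
    trans (cong (ρ w ∸ deg w +_) (*-identityʳ (deg w))) (trans (m∸n+n≡m full) (sym (+-identityʳ (ρ w))))
  ... | no w≢v rewrite dec-false (v ≟ w) (w≢v ∘ sym) | *-zeroʳ (deg w) with adj v w
  ...   | true  = trans (+-identityʳ (suc (ρ w))) (+-comm 1 (ρ w))
  ...   | false = refl

  balance-fire : ∀ {σ h ρ v} → Balance σ h ρ → deg v ≤ ρ v → Balance σ (add-firing h v) (fire ρ v)
  balance-fire {σ} {h} {ρ} {v} bal full w = begin
    fire ρ v w + deg w * (h w + δ)          ≡⟨ cong (fire ρ v w +_) (*-distribˡ-+ (deg w) (h w) δ) ⟩
    fire ρ v w + (deg w * h w + deg w * δ)  ≡⟨ x∙yz≈xz∙y (fire ρ v w) (deg w * h w) (deg w * δ) ⟩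
    fire ρ v w + deg w * δ + deg w * h w    ≡⟨ cong (_+ deg w * h w) (fire-balance full w) ⟩
    ρ w + a + deg w * h w                   ≡⟨ xy∙z≈xz∙y (ρ w) a (deg w * h w) ⟩
    ρ w + deg w * h w + a                   ≡⟨ cong (_+ a) (bal w) ⟩
    σ w + inflow w h + a                    ≡⟨ +-assoc (σ w) (inflow w h) a ⟩
    σ w + (inflow w h + a)                  ≡⟨ cong (σ w +_) (sym inflow-add-firing) ⟩
    σ w + inflow w (add-firing h v)         ∎
    where
    open ≡-Reasoning
    δ a : ℕ
    δ = if v == w then 1 else 0
    a = if adj v w then 1 else 0
    inflow-add-firing : inflow w (add-firing h v) ≡ inflow w h + a
    inflow-add-firing = trans (inflow-+ w h _) (cong (inflow w h +_) (inflow-point w v 1))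

  balance-run : ∀ {R σ h ρ p τ} → Run R ρ p τ → Balance σ h ρ → Balance σ (λ x → h x + count x p) τ
  balance-run (done _)              bal = balance-cong (λ x → sym (+-identityʳ _)) bal
  balance-run {h = h} (step {vs = p} v _ full run) bal =
    balance-cong (add-firing-count h v p) (balance-run run (balance-fire bal full))

  balance-addAt : ∀ {σ h ρ} u k → Balance σ h ρ → Balance (addAt σ u k) h (addAt ρ u k)
  balance-addAt {σ} {h} {ρ} u k bal w with w == u
  ... | true  = trans (xy∙z≈xz∙y (ρ w) k _) (trans (cong (_+ k) (bal w)) (xy∙z≈xz∙y (σ w) _ k))
  ... | false = bal w

  balance-stable : ∀ {σ h ρ v} → Balance σ h ρ → ρ v < deg v → σ v + inflow v h < deg v * suc (h v)
  balance-stable {h = h} {v = v} bal lt =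
    subst₂ _<_ (bal v) (sym (*-suc (deg v) (h v))) (+-monoˡ-< (deg v * h v) lt)

  balance-full : ∀ {σ h ρ v} → Balance σ h ρ → deg v ≤ ρ v → deg v * suc (h v) ≤ σ v + inflow v h
  balance-full {h = h} {v = v} bal le =
    subst₂ _≤_ (sym (*-suc (deg v) (h v))) (bal v) (+-monoˡ-≤ (deg v * h v) le)

  -- h records the firings already performed (reaching ρ).  The first vertex of S to exceed its
  -- budget u would have to fire from a configuration dominated by the stable σ + Δu.
  least-action : ∀ {S : Fin n → Set} {σ : Config n} (u : Fin n → ℕ) →
    (∀ v → S v → σ v + inflow v u < deg v * suc (u v)) →
    ∀ {R ρ p τ} (h : Fin n → ℕ) → Balance σ h ρ → Run R ρ p τ →
    (∀ x → h x ≤ u x) → (∀ x → ¬ S x → h x + count x p ≤ u x) →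
    ∀ x → h x + count x p ≤ u x
  least-action u stable h bal (done _) h≤u outside x = subst (_≤ u x) (sym (+-identityʳ (h x))) (h≤u x)
  least-action {S} {σ} u stable h bal (step {vs = p} v _ full run) h≤u outside x =
    subst (_≤ u x) (add-firing-count h v p x)
      (least-action u stable (add-firing h v) (balance-fire bal full) run add-firing≤u outside′ x)
    where
    saturated-∉S : u v ≤ h v → ¬ S v
    saturated-∉S uv≤hv v∈S = <⇒≱ (stable v v∈S) (begin
      deg v * suc (u v)  ≤⟨ *-monoʳ-≤ (deg v) (s≤s uv≤hv) ⟩
      deg v * suc (h v)  ≤⟨ balance-full bal full ⟩
      σ v + inflow v h   ≤⟨ +-monoʳ-≤ (σ v) (inflow-mono h≤u) ⟩
      σ v + inflow v u   ∎)
      where open ≤-Reasoning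
    saturated-∈S : u v ≤ h v → ¬ ¬ S v
    saturated-∈S uv≤hv v∉S =
      m+1+n≰m (h v) (≤-trans (subst (λ c → h v + c ≤ u v) (count-head v p) (outside v v∉S)) uv≤hv)
    hv<uv : h v < u v
    hv<uv = ≰⇒> λ uv≤hv → saturated-∈S uv≤hv (saturated-∉S uv≤hv)
    add-firing≤u : ∀ y → add-firing h v y ≤ u y
    add-firing≤u y with v ≟ y
    ... | yes refl = subst (_≤ u v) (+-comm 1 (h v)) hv<uv
    ... | no _     = subst (_≤ u y) (sym (+-identityʳ (h y))) (h≤u y)
    outside′ : ∀ y → ¬ S y → add-firing h v y + count y p ≤ u y
    outside′ y y∉S = subst (_≤ u y) (sym (add-firing-count h v p y)) (outside y y∉S)

  legal-≤-stabilizing : ∀ {R R′ σ p τ q ρ} → Run R σ p τ → Run R′ σ q ρ → (∀ w → ρ w < deg w) →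
                        ∀ x → count x p ≤ count x q
  legal-≤-stabilizing {σ = σ} {q = q} run-p run-q ρ-stable =
    least-action {S = λ _ → ⊤} (λ x → count x q)
      (λ v _ → balance-stable (balance-run run-q (balance-zero σ)) (ρ-stable v))
      (λ _ → 0) (balance-zero σ) run-p (λ _ → z≤n) (λ x x∉ → ⊥-elim (x∉ tt))

  addAt-≡-+ : ∀ (σ : Config n) u k v → addAt σ u k v ≡ σ v + (if v == u then k else 0)
  addAt-≡-+ σ u k v with v == u
  ... | true  = refl
  ... | false = sym (+-identityʳ (σ v))

  addAt-≢ : ∀ (σ : Config n) u k {w} → ¬ w ≡ u → addAt σ u k w ≡ σ w
  addAt-≢ σ u k {w} w≢u rewrite dec-false (w ≟ u) w≢u = refl

  module BelowVertex {u : Fin n} (u≢r : ¬ u ≡ root) where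

    S : Fin n → Set
    S = InSubtree u

    u∈S : S u
    u∈S = 0 , refl

    parent∉S : ¬ S (parent u)
    parent∉S = parent∉subtree u≢r

    splice : (Fin n → ℕ) → (Fin n → ℕ) → Fin n → ℕ
    splice c d x = if does (subtree? u x) then c x else d x

    splice-∈ : ∀ c d {x} → S x → splice c d x ≡ c x
    splice-∈ c d {x} x∈S = cong (if_then c x else d x) (dec-true (subtree? u x) x∈S)

    splice-∉ : ∀ c d {x} → ¬ S x → splice c d x ≡ d x
    splice-∉ c d {x} x∉S = cong (if_then c x else d x) (dec-false (subtree? u x) x∉S)

    adj-parent-subtree : ∀ {v} → S v → adj (parent u) v ≡ (v == u)
    adj-parent-subtree {v} v∈S with v ≟ u
    ... | yes refl = adj-parent u≢r
    ... | no v≢u   = ¬-not (λ a → v≢u (proj₁ (subtree-boundary v∈S parent∉S a)))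

    -- Chips entering subtree(u) from outside come from parent u and land on u.
    inflow-into-subtree : ∀ (σ : Config n) (c c′ : Fin n → ℕ) {v} → S v →
      (∀ x → S x → c x ≡ c′ x) → c′ (parent u) ≡ 0 →
      σ v + inflow v c ≡ addAt σ u (c (parent u)) v + inflow v c′
    inflow-into-subtree σ c c′ {v} v∈S c≗c′ c′-parent = begin
      σ v + inflow v c                                   ≡⟨ cong (σ v +_) (inflow-cong agree) ⟩
      σ v + inflow v (λ x → c′ x + from-parent x)        ≡⟨ cong (σ v +_) (inflow-+ v c′ from-parent) ⟩
      σ v + (inflow v c′ + inflow v from-parent)         ≡⟨ cong (λ z → σ v + (inflow v c′ + z)) (inflow-point v (parent u) k) ⟩
      σ v + (inflow v c′ + (if adj (parent u) v then k else 0))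
        ≡⟨ cong (λ b → σ v + (inflow v c′ + (if b then k else 0))) (adj-parent-subtree v∈S) ⟩
      σ v + (inflow v c′ + (if v == u then k else 0))    ≡⟨ x∙yz≈xz∙y (σ v) (inflow v c′) _ ⟩
      σ v + (if v == u then k else 0) + inflow v c′      ≡⟨ cong (_+ inflow v c′) (sym (addAt-≡-+ σ u k v)) ⟩
      addAt σ u k v + inflow v c′                        ∎
      where
      open ≡-Reasoning
      k : ℕ
      k = c (parent u)
      from-parent : Fin n → ℕ
      from-parent x = if parent u == x then k else 0
      agree : ∀ x → adj x v ≡ true → c x ≡ c′ x + from-parent x
      agree x a with parent u ≟ x
      ... | yes refl = sym (cong (_+ k) c′-parent)
      ... | no pu≢x  = trans (c≗c′ x x∈S) (sym (+-identityʳ (c′ x)))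
        where
        x∈S : S x
        x∈S = decidable-stable (subtree? u x) (λ x∉S → pu≢x (sym (proj₂ (subtree-boundary v∈S x∉S a))))

    inflow-parent : ∀ (c : Fin n → ℕ) → (∀ x → ¬ S x → c x ≡ 0) → inflow (parent u) c ≡ c u
    inflow-parent c vanish = begin
      inflow (parent u) c                                ≡⟨ inflow-cong agree ⟩
      inflow (parent u) (λ x → if u == x then c u else 0) ≡⟨ inflow-point (parent u) u (c u) ⟩
      (if adj u (parent u) then c u else 0)              ≡⟨ cong (if_then c u else 0) (trans (adj-sym u (parent u)) (adj-parent u≢r)) ⟩
      c u                                                ∎
      where
      open ≡-Reasoning
      agree : ∀ x → adj x (parent u) ≡ true → c x ≡ (if u == x then c u else 0)
      agree x a with u ≟ x
      ... | yes refl = refl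
      ... | no u≢x   =
        vanish x (λ x∈S → u≢x (sym (proj₁ (subtree-boundary x∈S parent∉S (trans (adj-sym (parent u) x) a)))))

    run-parent-gain : ∀ {ρ₀ p ρ} → Run S ρ₀ p ρ → ρ (parent u) ≡ ρ₀ (parent u) + count u p
    run-parent-gain {ρ₀} {p} {ρ} run = begin
      ρ (parent u)                                               ≡⟨ sym (+-identityʳ _) ⟩
      ρ (parent u) + 0                                           ≡⟨ cong (ρ (parent u) +_) (sym (*-zeroʳ (deg (parent u)))) ⟩
      ρ (parent u) + deg (parent u) * 0                          ≡⟨ cong (λ z → ρ (parent u) + deg (parent u) * z) (sym (run-outside run (parent u) parent∉S)) ⟩
      ρ (parent u) + deg (parent u) * count (parent u) p         ≡⟨ balance-run run (balance-zero ρ₀) (parent u) ⟩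
      ρ₀ (parent u) + inflow (parent u) (λ x → count x p)        ≡⟨ cong (ρ₀ (parent u) +_) (inflow-parent _ (run-outside run)) ⟩
      ρ₀ (parent u) + count u p                                  ∎
      where open ≡-Reasoning

    global-≤-local : ∀ {σ fs τ gs τu hs ρ} → Run Everywhere σ fs τ → Run S σ gs τu →
      Run S (addAt τu u (count (parent u) fs)) hs ρ → StableOn S ρ →
      count u fs ≤ count u gs + count u hs
    global-≤-local {σ} {fs} {τ} {gs} {τu} {hs} {ρ} run-fs run-gs run-hs ρ-stable =
      subst (count u fs ≤_) (splice-∈ G+H F u∈S)
        (least-action U U-stable (λ _ → 0) (balance-zero σ) run-fs (λ _ → z≤n) outside u)
      where
      F G+H U : Fin n → ℕ
      F x = count x fs
      G+H x = count x gs + count x hs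
      U = splice G+H F
      balance-local : Balance (addAt σ u (F (parent u))) G+H ρ
      balance-local = balance-run run-hs (balance-addAt u _ (balance-run run-gs (balance-zero σ)))
      U-stable : ∀ v → S v → σ v + inflow v U < deg v * suc (U v)
      U-stable v v∈S = begin-strict
        σ v + inflow v U
          ≡⟨ inflow-into-subtree σ U G+H v∈S (λ x → splice-∈ G+H F)
               (cong₂ _+_ (run-outside run-gs _ parent∉S) (run-outside run-hs _ parent∉S)) ⟩
        addAt σ u (U (parent u)) v + inflow v G+H
          ≡⟨ cong (λ k → addAt σ u k v + inflow v G+H) (splice-∉ G+H F parent∉S) ⟩
        addAt σ u (F (parent u)) v + inflow v G+H   <⟨ balance-stable balance-local (ρ-stable v v∈S) ⟩
        deg v * suc (G+H v)                         ≡⟨ cong (λ z → deg v * suc z) (sym (splice-∈ G+H F v∈S)) ⟩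
        deg v * suc (U v)                           ∎
        where open ≤-Reasoning
      outside : ∀ x → ¬ S x → count x fs ≤ U x
      outside x x∉S = ≤-reflexive (sym (splice-∉ G+H F x∉S))

    local-≤-global : ∀ {σ fs τ gs τu hs ρ} → Run Everywhere σ fs τ → StableOn Everywhere τ → Run S σ gs τu →
      Run S (addAt τu u (count (parent u) fs)) hs ρ →
      count u gs + count u hs ≤ count u fs
    local-≤-global {σ} {fs} {τ} {gs} {τu} {hs} {ρ} run-fs τ-stable run-gs run-hs =
      subst (count u gs + count u hs ≤_) (splice-∈ F (λ _ → 0) u∈S)
        (least-action V V-stable G (balance-addAt u _ balance-gs) run-hs G≤V outside u)
      where
      F G V : Fin n → ℕ
      F x = count x fs
      G x = count x gs
      V = splice F (λ _ → 0)
      σ′ : Config n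
      σ′ = addAt σ u (F (parent u))
      balance-gs : Balance σ G τu
      balance-gs = balance-run run-gs (balance-zero σ)
      V-stable : ∀ v → S v → σ′ v + inflow v V < deg v * suc (V v)
      V-stable v v∈S = begin-strict
        σ′ v + inflow v V
          ≡⟨ sym (inflow-into-subtree σ F V v∈S (λ x x∈S → sym (splice-∈ F _ x∈S)) (splice-∉ F _ parent∉S)) ⟩
        σ v + inflow v F    <⟨ balance-stable (balance-run run-fs (balance-zero σ)) (τ-stable v tt) ⟩
        deg v * suc (F v)   ≡⟨ cong (λ z → deg v * suc z) (sym (splice-∈ F _ v∈S)) ⟩
        deg v * suc (V v)   ∎
        where open ≤-Reasoning
      σ≤σ′ : ∀ v → σ v ≤ σ′ v
      σ≤σ′ v = ≤-trans (m≤m+n (σ v) _) (≤-reflexive (sym (addAt-≡-+ σ u _ v)))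
      G≤V : ∀ x → G x ≤ V x
      G≤V = least-action V (λ v v∈S → ≤-<-trans (+-monoˡ-≤ (inflow v V) (σ≤σ′ v)) (V-stable v v∈S))
        (λ _ → 0) (balance-zero σ) run-gs (λ _ → z≤n)
        (λ x x∉S → ≤-reflexive (trans (run-outside run-gs x x∉S) (sym (splice-∉ F _ x∉S))))
      outside : ∀ x → ¬ S x → G x + count x hs ≤ V x
      outside x x∉S = ≤-reflexive (trans (cong₂ _+_ (run-outside run-gs x x∉S) (run-outside run-hs x x∉S))
                                         (sym (splice-∉ F _ x∉S)))

    firing-count-below : ∀ {σ fs τ gs τu hs ρ} → Run Everywhere σ fs τ → StableOn Everywhere τ →
      Run S σ gs τu → Run S (addAt τu u (count (parent u) fs)) hs ρ → StableOn S ρ →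
      count u fs ≡ count u gs + (ρ (parent u) ∸ τu (parent u))
    firing-count-below {σ} {fs} {τ} {gs} {τu} {hs} {ρ} run-fs τ-stable run-gs run-hs ρ-stable = begin
      count u fs
        ≡⟨ ≤-antisym (global-≤-local run-fs run-gs run-hs ρ-stable) (local-≤-global run-fs τ-stable run-gs run-hs) ⟩
      count u gs + count u hs
        ≡⟨ cong (count u gs +_) (sym (m+n∸m≡n (τu (parent u)) (count u hs))) ⟩
      count u gs + (τu (parent u) + count u hs ∸ τu (parent u))
        ≡⟨ cong (λ z → count u gs + (z ∸ τu (parent u))) (sym parent-gain) ⟩
      count u gs + (ρ (parent u) ∸ τu (parent u))
        ∎
      where
      open ≡-Reasoning
      parent-gain : ρ (parent u) ≡ τu (parent u) + count u hs
      parent-gain = trans (run-parent-gain run-hs) (cong (_+ count u hs) (addAt-≢ τu u _ (parent-≢ u≢r)))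

lemma3p7 : ∀ {n} (T : RootedTree n) (σ : Config n) →
    let open RootedTree T
        open Sandpile T
    in ∀ (fs : List (Fin n)) (τ : Config n) →
       Run Everywhere σ fs τ → StableOn Everywhere τ →
       ((∀ (gs : List (Fin n)) (ρ : Config n) →
           Run (InSubtree root) σ gs ρ → StableOn (InSubtree root) ρ →
           count root fs ≡ count root gs)
       × (∀ (u : Fin n) → ¬ (u ≡ root) →
           ∀ (gs : List (Fin n)) (τu : Config n) →
           Run (InSubtree u) σ gs τu → StableOn (InSubtree u) τu →
           ∀ (hs : List (Fin n)) (ρ : Config n) →
           Run (InSubtree u) (addAt τu u (count (parent u) fs)) hs ρ →
           StableOn (InSubtree u) ρ →
           count u fs ≡ count u gs + (ρ (parent u) ∸ τu (parent u))))
lemma3p7 T σ fs τ run-fs τ-stable =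
    (λ gs ρ run-gs ρ-stable →
       ≤-antisym (legal-≤-stabilizing run-fs run-gs (λ w → ρ-stable w (subtree-root w)) root)
                 (legal-≤-stabilizing run-gs run-fs (λ w → τ-stable w tt) root))
  -- τu need not be stable: gs followed by hs stabilizes σ + count (parent u) fs · e_u on subtree(u) either way.
  , (λ u u≢r gs τu run-gs _ hs ρ run-hs ρ-stable →
       BelowVertex.firing-count-below u≢r run-fs τ-stable run-gs run-hs ρ-stable)
  where
  open RootedTree T
  open OnTree T
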